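{- Let $X = \mathrm{Cay}(\mathbb{Z}_n, S)$ be a connected, nonbipartite, loopless circulant graph (so $0 \notin S$), let $\alpha$ be an automorphism of $BX$, and let $t \in \mathbb{Z}_n$. If $\alpha(0,1) = (t,1)$, then $S$ does not contain any generator of the subgroup $\langle t \rangle$.
   Context: For $S \subseteq \mathbb{Z}_n$ with $-S = S$, $\mathrm{Cay}(\mathbb{Z}_n,S)$ has vertex set $\mathbb{Z}_n$ with $v \sim w$ iff $w - v \in S$. The canonical bipartite double cover $BX$ has vertex set $\mathbb{Z}_n\times\{0,1\}$ with $(v,0)\sim(w,1)$ iff $w-v\in S$ (and no other edges). -}

module Defs where

open import Data.Nat using (ℕ; _+_; _*_; _∸_; NonZero)
open import Data.Nat.DivMod using (_mod_)
open import Data.Fin using (Fin; toℕ)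
open import Data.Fin.Subset using (Subset; _∈_; _∉_)
open import Data.Bool using (Bool; true; false)
open import Data.Product using (_×_; _,_; ∃)
open import Data.Empty using (⊥)
open import Relation.Nullary using (¬_)
open import Relation.Binary.PropositionalEquality using (_≡_; _≢_)
open import Relation.Binary.Construct.Closure.ReflexiveTransitive using (Star)
open import Function.Definitions using (Bijective)
open import Function.Bundles using (_⇔_)

module _ (n : ℕ) .{{_ : NonZero n}} where

  0ₙ : Fin n
  0ₙ = 0 mod n

  subₙ : Fin n → Fin n → Fin n
  subₙ v w = (toℕ v + (n ∸ toℕ w)) mod n

  negₙ : Fin n → Fin n
  negₙ v = subₙ 0ₙ v

  smul : ℕ → Fin n → Fin n
  smul k t = (k * toℕ t) mod n

  InCyclic : Fin n → Fin n → Set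
  InCyclic t x = ∃ λ (k : ℕ) → x ≡ smul k t

  GeneratorOf : Fin n → Fin n → Set
  GeneratorOf t g = InCyclic t g × InCyclic g t

  SymmetricSet : Subset n → Set
  SymmetricSet S = ∀ s → s ∈ S → negₙ s ∈ S

  CayAdj : Subset n → Fin n → Fin n → Set
  CayAdj S v w = subₙ w v ∈ S

  CayConnected : Subset n → Set
  CayConnected S = ∀ v w → Star (CayAdj S) v w

  CayBipartite : Subset n → Set
  CayBipartite S = ∃ λ (c : Fin n → Bool) → ∀ v w → CayAdj S v w → c v ≢ c w

  Loopless : Subset n → Set
  Loopless S = 0ₙ ∉ S

  -- canonical bipartite double cover BX: vertex set Z_n × {0,1}
  -- (false = 0, true = 1); (v,0) ~ (w,1) iff w - v ∈ S, and no other edges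
  BVertex : Set
  BVertex = Fin n × Bool

  BAdj : Subset n → BVertex → BVertex → Set
  BAdj S (v , false) (w , true)  = subₙ w v ∈ S
  BAdj S (v , true)  (w , false) = subₙ v w ∈ S
  BAdj S (v , false) (w , false) = ⊥
  BAdj S (v , true)  (w , true)  = ⊥

  IsBAut : Subset n → (BVertex → BVertex) → Set
  IsBAut S α = Bijective _≡_ _≡_ α × (∀ x y → BAdj S x y ⇔ BAdj S (α x) (α y))

-- Write t = k g with k coprime to 2n; this is possible because g and t generate the same subgroup.
-- For an odd prime p coprime to n, the walks of length p between the two sides of BX are counted by
-- (Σ_{s ∈ S} τ_s)^p for the commuting translations τ_s, which is Σ_{s ∈ S} τ_{ps} modulo p.
-- As p is invertible modulo n, this count is 1 or 0 modulo p according as the endpoints are adjacent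
-- in B Cay(ℤₙ, pS) or not. Walk counts are invariant under α, so α is also an automorphism of
-- B Cay(ℤₙ, pS), and by induction over the prime factors of k, of B Cay(ℤₙ, kS). There (0,0) ~ (t,1)
-- because t = k g with g ∈ S; pulling back along α gives (0,0) ~ (0,1), so 0 ∈ kS, and hence 0 ∈ S.

module Submission where

open import Defs
open import Level using (0ℓ)
open import Data.Bool using (Bool; true; false; not; _∧_)
open import Data.Bool.Properties using (not-involutive; not-¬) renaming (_≟_ to _≟ᵇ_)
open import Data.Fin using (Fin; zero; suc; toℕ; _↑ˡ_; _↑ʳ_; splitAt; join) renaming (_≟_ to _≟ᶠ_)
open import Data.Fin.Permutation using (permutation)
open import Data.Fin.Properties
  using (any?; 0≢1+n; suc-injective; splitAt-↑ˡ; splitAt-↑ʳ; join-splitAt; toℕ-injective; toℕ<n; toℕ-fromℕ<)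
open import Data.Fin.Subset using (Subset; _∈_; _∉_; _⊆_; inside; outside)
open import Data.Fin.Subset.Properties using (_∈?_; ⊆-antisym)
open import Data.List using (List; []; _∷_; map)
open import Data.List.Properties using (map-cong; map-∘)
open import Data.List.Relation.Unary.All as All using (All; []; _∷_)
open import Data.Nat
  using (ℕ; zero; suc; _+_; _*_; _∸_; _≤_; _<_; _!; _%_; _/_; z≤n; s≤s; z<s; NonZero
        ; >-nonZero; >-nonZero⁻¹; ≢-nonZero; ≢-nonZero⁻¹; nonTrivial⇒n>1)
open import Data.Nat.Combinatorics
  using (_C_; nCk≡n!/k![n-k]!; k![n∸k]!∣n!; nCk+nC[k+1]≡[n+1]C[k+1]; nCn≡1; k>n⇒nCk≡0)
open import Data.Nat.Coprimality using (Coprime; gcd≡1⇒coprime; coprime-divisor; coprime-/gcd)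
import Data.Nat.Coprimality as Coprime
open import Data.Nat.Divisibility
  using (_∣_; divides; _∣0; n∣m*n; ∣-refl; ∣-trans; ∣1⇒≡1; ∣⇒≤; m∣m*n; ∣m⇒∣m*n; ∣n⇒∣m*n; ∣m∣n⇒∣m+n; ∣m+n∣m⇒∣n
        ; *-cancelʳ-∣; n∣m⇒m%n≡0)
open import Data.Nat.DivMod
  using (m≡m%n+[m/n]*n; m%n<n; m%n%n≡m%n; n%n≡0; [m+n]%n≡m%n; [m+kn]%n≡m%n; m<n⇒m%n≡m
        ; %-distribˡ-+; %-distribˡ-*; m/n*n≡m; m*[n/m]≡n; m/n<m; _mod_)
open import Data.Nat.GCD using (gcd; gcd[m,n]∣m; gcd[m,n]∣n; gcd[m,n]≡0⇒m≡0)
open import Data.Nat.GeneralisedArithmetic using (iterate)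
open import Data.Nat.Induction using (<-rec)
open import Data.Nat.ListAction using (sum; product)
open import Data.Nat.ListAction.Properties using (∈⇒∣product)
open import Data.Nat.Primality using (Prime; euclidsLemma; ¬prime[1]; prime⇒nonTrivial)
open import Data.Nat.Primality.Factorisation using (PrimeFactorisation; factorise)
open import Data.Nat.Properties
  using (_≟_; +-assoc; +-comm; +-identityʳ; *-assoc; *-comm; *-identityˡ; *-zeroʳ
        ; *-distribˡ-+; *-distribʳ-+; *-distribˡ-∸; *-distribʳ-∸; +-∸-assoc; m+[n∸m]≡n; m+n∸m≡n
        ; m∸n+n≡m; [m+n]∸[m+o]≡n∸o; m∸n≡0⇒m≤n; m∸n≤m; n∸n≡0; ∸-monoʳ-<; n<1+n; <-trans; ≤-<-trans
        ; <⇒≤; <⇒≱; ≤-antisym; ≤∧≢⇒<; n≢0⇒n>0; m*n≢0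
        ; _!*_!≢0; +-commutativeSemigroup; *-commutativeSemigroup; +-*-semiring)
open import Algebra.Properties.CommutativeSemigroup +-commutativeSemigroup
  using (xy∙z≈y∙xz; x∙yz≈y∙xz; xy∙z≈xz∙y) renaming (interchange to +-interchange)
import Algebra.Properties.CommutativeSemigroup *-commutativeSemigroup as *-Semigroup
open import Algebra.Properties.Semiring.Sum +-*-semiring
  using (sum-syntax; sum-permute; sum-cong-≗; sum-replicate-zero; *-distribˡ-sum) renaming (sum to ∑)
open import Data.Nat.Tactic.RingSolver using (solve-∀)
open import Data.Product using (∃; _×_; _,_; proj₁; proj₂; uncurry)
open import Data.Product.Properties using (,-injective)
open import Data.Sum using (inj₁; inj₂; [_,_]′)
open import Data.Vec using ([]; _∷_; tabulate)
open import Data.Vec.Properties using (lookup∘tabulate; []=⇒lookup; lookup⇒[]=)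
open import Function using (_∘_; id; _⇔_; _↔_; Inverse; Equivalence; mk⇔; mk↔ₛ′)
open import Function.Bundles using (mk⤖)
open import Function.Construct.Composition using (_↔-∘_)
open import Function.Definitions using (Bijective)
import Function.Properties.Equivalence as ⇔
open import Function.Properties.Bijection using (⤖⇒↔)
open import Function.Properties.Inverse using (↔-sym)
open import Relation.Binary using (Setoid)
open import Relation.Binary.Definitions using (DecidableEquality)
import Relation.Binary.Construct.On as On
import Relation.Binary.Reasoning.Setoid
open import Relation.Binary.PropositionalEquality
open import Relation.Nullary using (¬_; Dec; does; yes; no; contradiction)
import Relation.Nullary.Decidable as Dec
open import Relation.Nullary.Decidable using (_×-dec_; dec-true; dec-false; does-⇔)
open import Relation.Unary using (Pred; Decidable)

indicator : Bool → ℕ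
indicator true = 1
indicator false = 0

indicator-∧ : ∀ a b → indicator (a ∧ b) ≡ indicator a * indicator b
indicator-∧ true b = sym (+-identityʳ (indicator b))
indicator-∧ false b = refl

indicator-injective : ∀ {a b} → indicator a ≡ indicator b → a ≡ b
indicator-injective {true} {true} _ = refl
indicator-injective {false} {false} _ = refl

indicator< : ∀ b {p} → 1 < p → indicator b < p
indicator< true 1<p = 1<p
indicator< false 1<p = <-trans z<s 1<p

residue-unique : ∀ {a b p K K′} → a < p → b < p → a + K * p ≡ b + K′ * p → a ≡ b
residue-unique {a} {b} {p} {K} {K′} a<p b<p eq = begin
  a                ≡⟨ m<n⇒m%n≡m a<p ⟨
  a % p            ≡⟨ [m+kn]%n≡m%n a K p ⟨
  (a + K * p) % p  ≡⟨ cong (_% p) eq ⟩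
  (b + K′ * p) % p ≡⟨ [m+kn]%n≡m%n b K′ p ⟩
  b % p            ≡⟨ m<n⇒m%n≡m b<p ⟩
  b                ∎
  where
  open ≡-Reasoning
  instance _ = >-nonZero (≤-<-trans z≤n a<p)

dec-true⁻¹ : ∀ {A : Set} (a? : Dec A) → does a? ≡ true → A
dec-true⁻¹ (yes a) _ = a
dec-true⁻¹ (no _) ()

does-⇔⁻¹ : ∀ {A B : Set} (a? : Dec A) (b? : Dec B) → does a? ≡ does b? → A ⇔ B
does-⇔⁻¹ a? b? eq = mk⇔ (λ a → dec-true⁻¹ b? (trans (sym eq) (dec-true a? a)))
                        (λ b → dec-true⁻¹ a? (trans eq (dec-true b? b)))

iterate-not-odd : ∀ {p} → ¬ 2 ∣ p → ∀ i → iterate not i p ≡ not i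
iterate-not-odd {zero} 2∤p i = contradiction (2 ∣0) 2∤p
iterate-not-odd {suc zero} 2∤p i = refl
iterate-not-odd {suc (suc p)} 2∤p i =
  trans (cong (λ b → iterate not b p) (not-involutive i)) (iterate-not-odd (2∤p ∘ ∣m∣n⇒∣m+n ∣-refl) i)

coprime-∣ˡ : ∀ {d k m} → d ∣ k → Coprime k m → Coprime d m
coprime-∣ˡ d∣k k⊥m (i∣d , i∣m) = k⊥m (∣-trans i∣d d∣k , i∣m)

coprime-∣ʳ : ∀ {d k m} → d ∣ m → Coprime k m → Coprime k d
coprime-∣ʳ d∣m k⊥m = Coprime.sym (coprime-∣ˡ d∣m (Coprime.sym k⊥m))

-- Binomial coefficients modulo a prime

prime∤! : ∀ {p m} → Prime p → m < p → ¬ p ∣ m !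
prime∤! {m = zero} pr _ p∣1 = ¬prime[1] (subst Prime (∣1⇒≡1 p∣1) pr)
prime∤! {m = suc m} pr m<p p∣m! with euclidsLemma (suc m) (m !) pr p∣m!
... | inj₁ p∣m = <⇒≱ m<p (∣⇒≤ p∣m)
... | inj₂ p∣m! = prime∤! pr (<-trans (n<1+n m) m<p) p∣m!

prime∣C : ∀ {p k} → Prime p → 0 < k → k < p → p ∣ p C k
prime∣C {p@(suc p-1)} {k} pr 0<k k<p with euclidsLemma (p C k) (k ! * (p ∸ k) !) pr p∣product
  where
  instance _ = k !* (p ∸ k) !≢0
  p∣product : p ∣ (p C k) * (k ! * (p ∸ k) !)
  p∣product = subst (p ∣_) (sym (begin
    (p C k) * (k ! * (p ∸ k) !)                 ≡⟨ cong (_* (k ! * (p ∸ k) !)) (nCk≡n!/k![n-k]! (<⇒≤ k<p)) ⟩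
    p ! / (k ! * (p ∸ k) !) * (k ! * (p ∸ k) !) ≡⟨ m/n*n≡m (k![n∸k]!∣n! (<⇒≤ k<p)) ⟩
    p !                                         ∎)) (m∣m*n (p-1 !))
    where open ≡-Reasoning
... | inj₁ p∣C = p∣C
... | inj₂ p∣k![p∸k]! with euclidsLemma (k !) ((p ∸ k) !) pr p∣k![p∸k]!
...   | inj₁ p∣k! = contradiction p∣k! (prime∤! pr k<p)
...   | inj₂ p∣[p∸k]! = contradiction p∣[p∸k]! (prime∤! pr (∸-monoʳ-< 0<k (<⇒≤ k<p)))

∑≤ : ℕ → (ℕ → ℕ) → ℕ
∑≤ zero f = f 0
∑≤ (suc L) f = f 0 + ∑≤ L (f ∘ suc)

syntax ∑≤ L (λ j → e) = ∑[ j ≤ L ] e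

∑≤-cong : ∀ L {f g} → (∀ j → j ≤ L → f j ≡ g j) → ∑≤ L f ≡ ∑≤ L g
∑≤-cong zero f≗g = f≗g 0 z≤n
∑≤-cong (suc L) f≗g = cong₂ _+_ (f≗g 0 z≤n) (∑≤-cong L (λ j j≤L → f≗g (suc j) (s≤s j≤L)))

∑≤-+ : ∀ L f g → ∑[ j ≤ L ] (f j + g j) ≡ ∑≤ L f + ∑≤ L g
∑≤-+ zero f g = refl
∑≤-+ (suc L) f g = trans (cong (f 0 + g 0 +_) (∑≤-+ L (f ∘ suc) (g ∘ suc))) (+-interchange (f 0) (g 0) _ _)

∑≤-last : ∀ L f → ∑≤ (suc L) f ≡ ∑≤ L f + f (suc L)
∑≤-last zero f = refl
∑≤-last (suc L) f = trans (cong (f 0 +_) (∑≤-last L (f ∘ suc))) (sym (+-assoc (f 0) _ _))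

∑≤-∣ : ∀ {d} L f → (∀ j → j ≤ L → d ∣ f j) → d ∣ ∑≤ L f
∑≤-∣ zero f d∣f = d∣f 0 z≤n
∑≤-∣ (suc L) f d∣f = ∣m∣n⇒∣m+n (d∣f 0 z≤n) (∑≤-∣ L (f ∘ suc) (λ j j≤L → d∣f (suc j) (s≤s j≤L)))

sum-map-∑≤ : ∀ {A : Set} L (h : A → ℕ → ℕ) xs →
             sum (map (λ x → ∑≤ L (h x)) xs) ≡ ∑[ j ≤ L ] sum (map (λ x → h x j) xs)
sum-map-∑≤ zero h [] = refl
sum-map-∑≤ (suc L) h [] = sum-map-∑≤ L (λ x → h x ∘ suc) []
sum-map-∑≤ L h (x ∷ xs) =
  trans (cong (∑≤ L (h x) +_) (sum-map-∑≤ L h xs)) (sym (∑≤-+ L (h x) (λ j → sum (map (λ y → h y j) xs))))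

binomialSum : ℕ → (ℕ → ℕ → ℕ) → ℕ
binomialSum L G = ∑[ j ≤ L ] ((L C j) * G (L ∸ j) j)

binomialSum-cong : ∀ L {G H} → (∀ a j → G a j ≡ H a j) → binomialSum L G ≡ binomialSum L H
binomialSum-cong L G≗H = ∑≤-cong L (λ j _ → cong ((L C j) *_) (G≗H (L ∸ j) j))

private
  a+0+[b+c]≡a+c+b : ∀ a b c → a + 0 + (b + c) ≡ a + c + b
  a+0+[b+c]≡a+c+b = solve-∀

binomialSum-suc : ∀ L G →
  binomialSum (suc L) G ≡ binomialSum L (λ a j → G (suc a) j) + binomialSum L (λ a j → G a (suc j))
binomialSum-suc L G = begin
  G (suc L) 0 + 0 + ∑[ j ≤ L ] ((suc L C suc j) * G (L ∸ j) (suc j))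
    ≡⟨ cong (G (suc L) 0 + 0 +_) (trans (∑≤-cong L pascal) (∑≤-+ L _ _)) ⟩
  G (suc L) 0 + 0 + (right + Y)
    ≡⟨ a+0+[b+c]≡a+c+b (G (suc L) 0) right Y ⟩
  G (suc L) 0 + Y + right
    ≡⟨ cong (_+ right) (shifted L) ⟩
  binomialSum L (λ a j → G (suc a) j) + right ∎
  where
  open ≡-Reasoning
  right = binomialSum L (λ a j → G a (suc j))
  Y = ∑[ j ≤ L ] ((L C suc j) * G (L ∸ j) (suc j))
  pascal : ∀ j → j ≤ L →
           (suc L C suc j) * G (L ∸ j) (suc j) ≡ (L C j) * G (L ∸ j) (suc j) + (L C suc j) * G (L ∸ j) (suc j)
  pascal j _ = trans (cong (_* G (L ∸ j) (suc j)) (sym (nCk+nC[k+1]≡[n+1]C[k+1] L j)))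
                     (*-distribʳ-+ (G (L ∸ j) (suc j)) (L C j) _)
  shifted : ∀ L → G (suc L) 0 + ∑[ j ≤ L ] ((L C suc j) * G (L ∸ j) (suc j)) ≡ binomialSum L (λ a j → G (suc a) j)
  shifted zero = refl
  shifted (suc L) = cong₂ _+_ (sym (+-identityʳ _)) (begin
    ∑[ j ≤ suc L ] ((suc L C suc j) * G (suc L ∸ j) (suc j))
      ≡⟨ ∑≤-last L _ ⟩
    ∑[ j ≤ L ] ((suc L C suc j) * G (suc L ∸ j) (suc j)) + (suc L C suc (suc L)) * G (L ∸ L) (suc (suc L))
      ≡⟨ cong₂ _+_ (∑≤-cong L (λ j j≤L → cong (λ a → (suc L C suc j) * G a (suc j)) (+-∸-assoc 1 j≤L)))
                   (cong (_* G (L ∸ L) (suc (suc L))) (k>n⇒nCk≡0 (n<1+n (suc L)))) ⟩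
    ∑[ j ≤ L ] ((suc L C suc j) * G (suc (L ∸ j)) (suc j)) + 0
      ≡⟨ +-identityʳ _ ⟩
    ∑[ j ≤ L ] ((suc L C suc j) * G (suc (L ∸ j)) (suc j)) ∎)

binomialSum-prime : ∀ {p} → Prime p → ∀ G → ∃ λ K → binomialSum p G ≡ G p 0 + G 0 p + K * p
binomialSum-prime {p@(suc (suc r))} pr G with ∑≤-∣ r middle p∣middle
  where
  middle : ℕ → ℕ
  middle j = (p C suc j) * G (suc r ∸ j) (suc j)
  p∣middle : ∀ j → j ≤ r → p ∣ middle j
  p∣middle j j≤r = ∣m⇒∣m*n _ (prime∣C pr (s≤s z≤n) (s≤s (s≤s j≤r)))
... | divides K ∑middle≡K*p = K , (begin
  G p 0 + 0 + ∑[ j ≤ suc r ] ((p C suc j) * G (suc r ∸ j) (suc j))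
    ≡⟨ cong (G p 0 + 0 +_) (∑≤-last r _) ⟩
  G p 0 + 0 + (∑[ j ≤ r ] ((p C suc j) * G (suc r ∸ j) (suc j)) + (p C p) * G (suc r ∸ suc r) p)
    ≡⟨ cong₂ (λ s g → G p 0 + 0 + (s + g)) ∑middle≡K*p last≡ ⟩
  G p 0 + 0 + (K * p + G 0 p)
    ≡⟨ a+0+[b+c]≡a+c+b (G p 0) (K * p) (G 0 p) ⟩
  G p 0 + G 0 p + K * p ∎)
  where
  open ≡-Reasoning
  last≡ : (p C p) * G (suc r ∸ suc r) p ≡ G 0 p
  last≡ = trans (cong₂ _*_ (nCn≡1 p) (cong (λ a → G a p) (n∸n≡0 (suc r)))) (*-identityˡ _)

sum-map-*ˡ : ∀ {A : Set} c (f : A → ℕ) xs → sum (map (λ x → c * f x) xs) ≡ c * sum (map f xs)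
sum-map-*ˡ c f [] = sym (*-zeroʳ c)
sum-map-*ˡ c f (x ∷ xs) = trans (cong (c * f x +_) (sum-map-*ˡ c f xs)) (sym (*-distribˡ-+ c (f x) _))

sum-map-binomialSum : ∀ {A : Set} L (H : A → ℕ → ℕ → ℕ) xs →
  sum (map (λ x → binomialSum L (H x)) xs) ≡ binomialSum L (λ a j → sum (map (λ x → H x a j) xs))
sum-map-binomialSum L H xs = trans (sum-map-∑≤ L (λ x j → (L C j) * H x (L ∸ j) j) xs)
  (∑≤-cong L (λ j _ → sum-map-*ˡ (L C j) (λ x → H x (L ∸ j) j) xs))

-- Counting walks

module CommutingSteps {X V : Set} (_≟_ : DecidableEquality V) (act : X → V → V)
                      (act-comm : ∀ x y v → act x (act y v) ≡ act y (act x v)) where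

  δ : V → V → ℕ
  δ v w = indicator (does (v ≟ w))

  walksBy : List X → ℕ → V → V → ℕ
  walksBy xs zero u w = δ u w
  walksBy xs (suc L) u w = sum (map (λ x → walksBy xs L (act x u) w) xs)

  act-iterate : ∀ x y u j → act y (iterate (act x) u j) ≡ iterate (act x) (act y u) j
  act-iterate x y u zero = refl
  act-iterate x y u (suc j) =
    trans (act-iterate x y (act x u) j) (cong (λ v → iterate (act x) v j) (act-comm y x u))

  walksBy-∷ : ∀ x ys L u w → walksBy (x ∷ ys) L u w ≡ binomialSum L (λ a j → walksBy ys a (iterate (act x) u j) w)
  walksBy-∷ x ys zero u w = sym (+-identityʳ _)
  walksBy-∷ x ys (suc L) u w = begin
    walksBy (x ∷ ys) L (act x u) w + sum (map (λ y → walksBy (x ∷ ys) L (act y u) w) ys)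
      ≡⟨ cong₂ _+_ (walksBy-∷ x ys L (act x u) w)
                   (trans (cong sum (map-cong (λ y → walksBy-∷ x ys L (act y u) w) ys)) (sum-map-binomialSum L H ys)) ⟩
    binomialSum L (λ a j → G a (suc j)) + binomialSum L (λ a j → sum (map (λ y → H y a j) ys))
      ≡⟨ cong (binomialSum L (λ a j → G a (suc j)) +_)
              (binomialSum-cong L (λ a j → cong sum (map-cong (λ y → cong (λ v → walksBy ys a v w)
                                                                         (sym (act-iterate x y u j))) ys))) ⟩
    binomialSum L (λ a j → G a (suc j)) + binomialSum L (λ a j → G (suc a) j)
      ≡⟨ +-comm (binomialSum L (λ a j → G a (suc j))) _ ⟩
    binomialSum L (λ a j → G (suc a) j) + binomialSum L (λ a j → G a (suc j))
      ≡⟨ sym (binomialSum-suc L G) ⟩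
    binomialSum (suc L) G ∎
    where
    open ≡-Reasoning
    G : ℕ → ℕ → ℕ
    G a j = walksBy ys a (iterate (act x) u j) w
    H : X → ℕ → ℕ → ℕ
    H y a j = walksBy ys a (iterate (act x) (act y u) j) w

  -- Frobenius: (x + ys)^p ≡ x^p + ys^p modulo p.
  walksBy-prime : ∀ {p} → Prime p → ∀ xs u w →
                  ∃ λ K → walksBy xs p u w ≡ sum (map (λ x → δ (iterate (act x) u p) w) xs) + K * p
  walksBy-prime {zero} () xs u w
  walksBy-prime {suc _} pr [] u w = 0 , refl
  walksBy-prime {p} pr (x ∷ ys) u w
    with walksBy-prime pr ys u w | binomialSum-prime pr (λ a j → walksBy ys a (iterate (act x) u j) w)
  ... | K , walks≡ | K′ , binomial≡ = K′ + K , (begin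
    walksBy (x ∷ ys) p u w                                     ≡⟨ walksBy-∷ x ys p u w ⟩
    binomialSum p (λ a j → walksBy ys a (iterate (act x) u j) w) ≡⟨ binomial≡ ⟩
    walksBy ys p u w + fixed x + K′ * p                         ≡⟨ cong (λ c → c + fixed x + K′ * p) walks≡ ⟩
    fixedAll + K * p + fixed x + K′ * p                         ≡⟨ regroup fixedAll K (fixed x) K′ p ⟩
    fixed x + fixedAll + (K′ + K) * p                           ∎)
    where
    open ≡-Reasoning
    fixed : X → ℕ
    fixed x = δ (iterate (act x) u p) w
    fixedAll = sum (map fixed ys)
    regroup : ∀ f k c k′ p → f + k * p + c + k′ * p ≡ c + f + (k′ + k) * p
    regroup = solve-∀

module FiniteWalks {m} {V : Set} (enumeration : Fin m ↔ V) (_≟_ : DecidableEquality V) where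

  open Inverse using (to; strictlyInverseˡ)

  ∑ᵥ : (V → ℕ) → ℕ
  ∑ᵥ f = ∑[ i < m ] f (to enumeration i)

  ∑ᵥ-bijective : ∀ {α} → Bijective _≡_ _≡_ α → ∀ f → ∑ᵥ f ≡ ∑ᵥ (f ∘ α)
  ∑ᵥ-bijective {α} α-bij f = trans (sum-permute (f ∘ to enumeration) σ)
    (sum-cong-≗ (λ i → cong f (strictlyInverseˡ enumeration (α (to enumeration i)))))
    where
    σ : Fin m ↔ Fin m
    σ = ↔-sym enumeration ↔-∘ (⤖⇒↔ (mk⤖ α-bij) ↔-∘ enumeration)

  walks : (V → V → ℕ) → ℕ → V → V → ℕ
  walks A zero x y = indicator (does (x ≟ y))
  walks A (suc L) x y = ∑ᵥ (λ z → A x z * walks A L z y)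

  walks-automorphism : ∀ A {α} → Bijective _≡_ _≡_ α → (∀ x y → A (α x) (α y) ≡ A x y) →
                       ∀ L x y → walks A L (α x) (α y) ≡ walks A L x y
  walks-automorphism A {α} α-bij A-inv zero x y =
    cong indicator (does-⇔ (mk⇔ (proj₁ α-bij) (cong α)) (α x ≟ α y) (x ≟ y))
  walks-automorphism A {α} α-bij A-inv (suc L) x y =
    trans (∑ᵥ-bijective α-bij (λ z → A (α x) z * walks A L z (α y)))
          (sum-cong-≗ {m} (λ i → cong₂ _*_ (A-inv x (to enumeration i))
                                           (walks-automorphism A α-bij A-inv L (to enumeration i) y)))

-- Units modulo n

CoprimePart : ℕ → ℕ → Set
CoprimePart b N = ∃ λ r → Coprime r b × (∀ {h} → h ∣ N → Coprime h b → h ∣ r)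

-- Divide out gcd N b until it is 1.
coprimePart : ∀ b N → N ≢ 0 → CoprimePart b N
coprimePart b = <-rec (λ N → N ≢ 0 → CoprimePart b N) step
  where
  step : ∀ N → (∀ {M} → M < N → M ≢ 0 → CoprimePart b M) → N ≢ 0 → CoprimePart b N
  step N rec N≢0 with gcd N b ≟ 1
  ... | yes c≡1 = N , gcd≡1⇒coprime c≡1 , (λ h∣N _ → h∣N)
  ... | no c≢1 = shrink (rec (m/n<m N c 1<c) N/c≢0)
    where
    c = gcd N b
    c≢0 : c ≢ 0
    c≢0 = N≢0 ∘ gcd[m,n]≡0⇒m≡0
    instance
      _ = ≢-nonZero N≢0
      _ = ≢-nonZero c≢0
    1<c : 1 < c
    1<c = ≤∧≢⇒< (n≢0⇒n>0 c≢0) (c≢1 ∘ sym)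
    c*[N/c]≡N : c * (N / c) ≡ N
    c*[N/c]≡N = m*[n/m]≡n (gcd[m,n]∣m N b)
    N/c≢0 : N / c ≢ 0
    N/c≢0 N/c≡0 = N≢0 (trans (sym c*[N/c]≡N) (trans (cong (c *_) N/c≡0) (*-zeroʳ c)))
    shrink : CoprimePart b (N / c) → CoprimePart b N
    shrink (r , r⊥b , maximal) = r , r⊥b , λ {h} h∣N h⊥b →
      maximal (coprime-divisor (coprime-∣ʳ (gcd[m,n]∣n N b) h⊥b) (subst (h ∣_) (sym c*[N/c]≡N) h∣N)) h⊥b

-- A common divisor of b + m * r and N is coprime to b, so it divides r, and then b.
coprime-lift : ∀ {b m} N → N ≢ 0 → Coprime b m → ∃ λ r → Coprime (b + m * r) N
coprime-lift {b} {m} N N≢0 b⊥m with coprimePart b N N≢0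
... | r , r⊥b , maximal = r , k⊥N
  where
  k⊥N : Coprime (b + m * r) N
  k⊥N {h} (h∣k , h∣N) = h⊥b (∣-refl , h∣b)
    where
    h⊥b : Coprime h b
    h⊥b {i} (i∣h , i∣b) =
      r⊥b (coprime-divisor (coprime-∣ˡ i∣b b⊥m) (∣m+n∣m⇒∣n (∣-trans i∣h h∣k) i∣b) , i∣b)
    h∣b : h ∣ b
    h∣b = ∣m+n∣m⇒∣n (subst (h ∣_) (+-comm b (m * r)) h∣k) (∣n⇒∣m*n m (maximal h∣N h⊥b))

m∣n*o⇒m/gcd[m,o]∣n : ∀ {m n o} .{{_ : NonZero (gcd m o)}} → m ∣ n * o → m / gcd m o ∣ n
m∣n*o⇒m/gcd[m,o]∣n {m} {n} {o} m∣no = coprime-divisor (coprime-/gcd m o)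
  (subst (m / d ∣_) (*-comm n (o / d)) (*-cancelʳ-∣ d (subst₂ _∣_ m≡ n*o≡ m∣no)))
  where
  d = gcd m o
  m≡ : m ≡ m / d * d
  m≡ = sym (m/n*n≡m (gcd[m,n]∣m m o))
  n*o≡ : n * o ≡ n * (o / d) * d
  n*o≡ = trans (cong (n *_) (sym (m/n*n≡m (gcd[m,n]∣n m o)))) (sym (*-assoc n (o / d) d))

m/gcd[m,o]*o≡o/gcd[m,o]*m : ∀ m o .{{_ : NonZero (gcd m o)}} → m / gcd m o * o ≡ o / gcd m o * m
m/gcd[m,o]*o≡o/gcd[m,o]*m m o = begin
  m / d * o           ≡⟨ cong (m / d *_) (m/n*n≡m (gcd[m,n]∣n m o)) ⟨
  m / d * (o / d * d) ≡⟨ *-Semigroup.x∙yz≈y∙xz (m / d) (o / d) d ⟩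
  o / d * (m / d * d) ≡⟨ cong (o / d *_) (m/n*n≡m (gcd[m,n]∣m m o)) ⟩
  o / d * m           ∎
  where
  open ≡-Reasoning
  d = gcd m o

-- Arithmetic in ℤₙ

module Modular (n : ℕ) .{{_ : NonZero n}} where

  infix 4 _≈_
  _≈_ : ℕ → ℕ → Set
  a ≈ b = a % n ≡ b % n

  ≈-setoid : Setoid 0ℓ 0ℓ
  ≈-setoid = On.setoid (setoid ℕ) (_% n)

  module ≈-Reasoning = Relation.Binary.Reasoning.Setoid ≈-setoid

  +-cong-≈ : ∀ {a a′ b b′} → a ≈ a′ → b ≈ b′ → a + b ≈ a′ + b′
  +-cong-≈ {a} {a′} {b} {b′} a≈a′ b≈b′ = begin
    (a + b) % n                ≡⟨ %-distribˡ-+ a b n ⟩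
    (a % n + b % n) % n        ≡⟨ cong₂ (λ x y → (x + y) % n) a≈a′ b≈b′ ⟩
    (a′ % n + b′ % n) % n      ≡⟨ %-distribˡ-+ a′ b′ n ⟨
    (a′ + b′) % n              ∎
    where open ≡-Reasoning

  *-cong-≈ : ∀ {a a′ b b′} → a ≈ a′ → b ≈ b′ → a * b ≈ a′ * b′
  *-cong-≈ {a} {a′} {b} {b′} a≈a′ b≈b′ = begin
    (a * b) % n                ≡⟨ %-distribˡ-* a b n ⟩
    (a % n * (b % n)) % n      ≡⟨ cong₂ (λ x y → (x * y) % n) a≈a′ b≈b′ ⟩
    (a′ % n * (b′ % n)) % n    ≡⟨ %-distribˡ-* a′ b′ n ⟨
    (a′ * b′) % n              ∎
    where open ≡-Reasoning

  n≈0 : n ≈ 0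
  n≈0 = trans (n%n≡0 n) (sym (m<n⇒m%n≡m (>-nonZero⁻¹ n)))

  toℕ-mod : ∀ a → toℕ (a mod n) ≈ a
  toℕ-mod a = trans (cong (_% n) (toℕ-fromℕ< (m%n<n a n))) (m%n%n≡m%n a n)

  toℕ-≈-injective : ∀ {u v : Fin n} → toℕ u ≈ toℕ v → u ≡ v
  toℕ-≈-injective {u} {v} u≈v =
    toℕ-injective (trans (sym (m<n⇒m%n≡m (toℕ<n u))) (trans u≈v (m<n⇒m%n≡m (toℕ<n v))))

  m+[n∸m]≈0 : ∀ (v : Fin n) → toℕ v + (n ∸ toℕ v) ≈ 0
  m+[n∸m]≈0 v = trans (cong (_% n) (m+[n∸m]≡n (<⇒≤ (toℕ<n v)))) n≈0

  ≈⇒∣∸ : ∀ {a b} → a ≈ b → n ∣ b ∸ a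
  ≈⇒∣∸ {a} {b} a≈b = divides (b / n ∸ a / n) (begin
    b ∸ a                                     ≡⟨ cong₂ _∸_ (m≡m%n+[m/n]*n b n) (m≡m%n+[m/n]*n a n) ⟩
    (b % n + b / n * n) ∸ (a % n + a / n * n) ≡⟨ cong (λ r → (b % n + b / n * n) ∸ (r + a / n * n)) a≈b ⟩
    (b % n + b / n * n) ∸ (b % n + a / n * n) ≡⟨ [m+n]∸[m+o]≡n∸o (b % n) _ _ ⟩
    b / n * n ∸ a / n * n                     ≡⟨ *-distribʳ-∸ n (b / n) (a / n) ⟨
    (b / n ∸ a / n) * n                       ∎)
    where open ≡-Reasoning

  infixl 6 _+ₙ_
  _+ₙ_ : Fin n → Fin n → Fin n
  u +ₙ v = (toℕ u + toℕ v) mod n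

  open ≈-Reasoning

  subₙ-+ₙ : ∀ u x → subₙ n (u +ₙ x) u ≡ x
  subₙ-+ₙ u x = toℕ-≈-injective (begin
    toℕ (subₙ n (u +ₙ x) u)            ≈⟨ toℕ-mod _ ⟩
    toℕ (u +ₙ x) + (n ∸ toℕ u)          ≈⟨ +-cong-≈ (toℕ-mod (toℕ u + toℕ x)) refl ⟩
    toℕ u + toℕ x + (n ∸ toℕ u)         ≡⟨ xy∙z≈y∙xz (toℕ u) (toℕ x) _ ⟩
    toℕ x + (toℕ u + (n ∸ toℕ u))       ≈⟨ +-cong-≈ {toℕ x} refl (m+[n∸m]≈0 u) ⟩
    toℕ x + 0                           ≡⟨ +-identityʳ (toℕ x) ⟩
    toℕ x                               ∎)

  +ₙ-subₙ : ∀ u v → u +ₙ subₙ n v u ≡ v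
  +ₙ-subₙ u v = toℕ-≈-injective (begin
    toℕ (u +ₙ subₙ n v u)               ≈⟨ toℕ-mod _ ⟩
    toℕ u + toℕ (subₙ n v u)            ≈⟨ +-cong-≈ {toℕ u} refl (toℕ-mod _) ⟩
    toℕ u + (toℕ v + (n ∸ toℕ u))       ≡⟨ x∙yz≈y∙xz (toℕ u) (toℕ v) _ ⟩
    toℕ v + (toℕ u + (n ∸ toℕ u))       ≈⟨ +-cong-≈ {toℕ v} refl (m+[n∸m]≈0 u) ⟩
    toℕ v + 0                           ≡⟨ +-identityʳ (toℕ v) ⟩
    toℕ v                               ∎)

  +ₙ-rightComm : ∀ u x y → u +ₙ x +ₙ y ≡ u +ₙ y +ₙ x
  +ₙ-rightComm u x y = toℕ-≈-injective (begin
    toℕ (u +ₙ x +ₙ y)           ≈⟨ toℕ-mod _ ⟩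
    toℕ (u +ₙ x) + toℕ y        ≈⟨ +-cong-≈ (toℕ-mod _) refl ⟩
    toℕ u + toℕ x + toℕ y       ≡⟨ xy∙z≈xz∙y (toℕ u) (toℕ x) (toℕ y) ⟩
    toℕ u + toℕ y + toℕ x       ≈⟨ +-cong-≈ (toℕ-mod _) refl ⟨
    toℕ (u +ₙ y) + toℕ x        ≈⟨ toℕ-mod _ ⟨
    toℕ (u +ₙ y +ₙ x)           ∎)

  toℕ-0ₙ : toℕ (0ₙ n) ≡ 0
  toℕ-0ₙ = trans (toℕ-fromℕ< (m%n<n 0 n)) (m<n⇒m%n≡m (>-nonZero⁻¹ n))

  toℕ-negₙ : ∀ v → toℕ (negₙ n v) ≈ n ∸ toℕ v
  toℕ-negₙ v = trans (toℕ-mod _) (cong (λ z → (z + (n ∸ toℕ v)) % n) toℕ-0ₙ)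

  negₙ-unique : ∀ a b → toℕ a + toℕ b ≈ 0 → negₙ n a ≡ b
  negₙ-unique a b a+b≈0 = toℕ-≈-injective (begin
    toℕ (negₙ n a)                    ≈⟨ toℕ-negₙ a ⟩
    n ∸ toℕ a                         ≡⟨ +-identityʳ _ ⟨
    (n ∸ toℕ a) + 0                   ≈⟨ +-cong-≈ {n ∸ toℕ a} refl a+b≈0 ⟨
    (n ∸ toℕ a) + (toℕ a + toℕ b)     ≡⟨ +-assoc (n ∸ toℕ a) (toℕ a) (toℕ b) ⟨
    (n ∸ toℕ a) + toℕ a + toℕ b       ≡⟨ cong (_+ toℕ b) (m∸n+n≡m (<⇒≤ (toℕ<n a))) ⟩
    n + toℕ b                         ≈⟨ +-cong-≈ n≈0 refl ⟩
    toℕ b                             ∎)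

  negₙ-subₙ : ∀ u v → negₙ n (subₙ n u v) ≡ subₙ n v u
  negₙ-subₙ u v = negₙ-unique (subₙ n u v) (subₙ n v u) (begin
    toℕ (subₙ n u v) + toℕ (subₙ n v u)         ≈⟨ +-cong-≈ (toℕ-mod _) (toℕ-mod _) ⟩
    toℕ u + (n ∸ toℕ v) + (toℕ v + (n ∸ toℕ u)) ≡⟨ regroup (toℕ u) (n ∸ toℕ v) (toℕ v) (n ∸ toℕ u) ⟩
    toℕ u + (n ∸ toℕ u) + (toℕ v + (n ∸ toℕ v)) ≈⟨ +-cong-≈ (m+[n∸m]≈0 u) (m+[n∸m]≈0 v) ⟩
    0                                           ∎)
    where
    regroup : ∀ a b c d → a + b + (c + d) ≡ a + d + (c + b)
    regroup = solve-∀

  toℕ-smul : ∀ k v → toℕ (smul n k v) ≈ k * toℕ v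
  toℕ-smul k v = toℕ-mod (k * toℕ v)

  negₙ-smul : ∀ k v → negₙ n (smul n k v) ≡ smul n k (negₙ n v)
  negₙ-smul k v = negₙ-unique (smul n k v) (smul n k (negₙ n v)) (begin
    toℕ (smul n k v) + toℕ (smul n k (negₙ n v)) ≈⟨ +-cong-≈ (toℕ-smul k v) (toℕ-smul k (negₙ n v)) ⟩
    k * toℕ v + k * toℕ (negₙ n v)                ≡⟨ *-distribˡ-+ k (toℕ v) _ ⟨
    k * (toℕ v + toℕ (negₙ n v))                  ≈⟨ *-cong-≈ {k} refl (+-cong-≈ {toℕ v} refl (toℕ-negₙ v)) ⟩
    k * (toℕ v + (n ∸ toℕ v))                     ≈⟨ *-cong-≈ {k} refl (m+[n∸m]≈0 v) ⟩
    k * 0                                         ≡⟨ *-zeroʳ k ⟩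
    0                                             ∎)

  smul-smul : ∀ q k v → smul n q (smul n k v) ≡ smul n (q * k) v
  smul-smul q k v = toℕ-≈-injective (begin
    toℕ (smul n q (smul n k v)) ≈⟨ toℕ-smul q _ ⟩
    q * toℕ (smul n k v)        ≈⟨ *-cong-≈ {q} refl (toℕ-smul k v) ⟩
    q * (k * toℕ v)             ≡⟨ *-assoc q k (toℕ v) ⟨
    q * k * toℕ v               ≈⟨ toℕ-smul (q * k) v ⟨
    toℕ (smul n (q * k) v)      ∎)

  smul-identityˡ : ∀ v → smul n 1 v ≡ v
  smul-identityˡ v = toℕ-≈-injective (trans (toℕ-smul 1 v) (cong (_% n) (*-identityˡ (toℕ v))))

  +ₙ-smul-suc : ∀ u x j → u +ₙ x +ₙ smul n j x ≡ u +ₙ smul n (suc j) x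
  +ₙ-smul-suc u x j = toℕ-≈-injective (begin
    toℕ (u +ₙ x +ₙ smul n j x)        ≈⟨ toℕ-mod _ ⟩
    toℕ (u +ₙ x) + toℕ (smul n j x)   ≈⟨ +-cong-≈ (toℕ-mod _) (toℕ-smul j x) ⟩
    toℕ u + toℕ x + j * toℕ x         ≡⟨ +-assoc (toℕ u) (toℕ x) _ ⟩
    toℕ u + suc j * toℕ x             ≈⟨ +-cong-≈ {toℕ u} refl (toℕ-smul (suc j) x) ⟨
    toℕ u + toℕ (smul n (suc j) x)    ≈⟨ toℕ-mod _ ⟨
    toℕ (u +ₙ smul n (suc j) x)       ∎)

  iterate-+ₙ : ∀ x u j → iterate (_+ₙ x) u j ≡ u +ₙ smul n j x
  iterate-+ₙ x u zero = toℕ-≈-injective (begin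
    toℕ u                       ≡⟨ +-identityʳ (toℕ u) ⟨
    toℕ u + 0                   ≈⟨ +-cong-≈ {toℕ u} refl (toℕ-smul 0 x) ⟨
    toℕ u + toℕ (smul n 0 x)    ≈⟨ toℕ-mod _ ⟨
    toℕ (u +ₙ smul n 0 x)       ∎)
  iterate-+ₙ x u (suc j) = trans (iterate-+ₙ x (u +ₙ x) j) (+ₙ-smul-suc u x j)

  subₙ-self : ∀ v → subₙ n v v ≡ 0ₙ n
  subₙ-self v = toℕ-≈-injective (trans (toℕ-mod _) (trans (m+[n∸m]≈0 v) (cong (_% n) (sym toℕ-0ₙ))))

  subₙ-0ₙ : ∀ v → subₙ n v (0ₙ n) ≡ v
  subₙ-0ₙ v = toℕ-≈-injective (begin
    toℕ (subₙ n v (0ₙ n))       ≈⟨ toℕ-mod _ ⟩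
    toℕ v + (n ∸ toℕ (0ₙ n))    ≡⟨ cong (λ z → toℕ v + (n ∸ z)) toℕ-0ₙ ⟩
    toℕ v + n                   ≈⟨ [m+n]%n≡m%n (toℕ v) n ⟩
    toℕ v                       ∎)

  smul-0ₙ : ∀ k → smul n k (0ₙ n) ≡ 0ₙ n
  smul-0ₙ k = toℕ-≈-injective (begin
    toℕ (smul n k (0ₙ n))   ≈⟨ toℕ-smul k (0ₙ n) ⟩
    k * toℕ (0ₙ n)          ≡⟨ cong (k *_) toℕ-0ₙ ⟩
    k * 0                   ≡⟨ *-zeroʳ k ⟩
    0                       ≡⟨ toℕ-0ₙ ⟨
    toℕ (0ₙ n)              ∎)

  +ₙ-≡⇔ : ∀ {u y w} → u +ₙ y ≡ w ⇔ y ≡ subₙ n w u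
  +ₙ-≡⇔ {u} {y} {w} = mk⇔ (λ u+y≡w → trans (sym (subₙ-+ₙ u y)) (cong (λ v → subₙ n v u) u+y≡w))
                         (λ y≡w-u → trans (cong (u +ₙ_) y≡w-u) (+ₙ-subₙ u w))

  smul-injective : ∀ {k} → Coprime k n → ∀ {u v} → smul n k u ≡ smul n k v → u ≡ v
  smul-injective {k} k⊥n {u} {v} ku≡kv =
    toℕ-injective (≤-antisym (m∸n≡0⇒m≤n (∸≡0 (sym ku≈kv))) (m∸n≡0⇒m≤n (∸≡0 ku≈kv)))
    where
    ku≈kv : k * toℕ u ≈ k * toℕ v
    ku≈kv = begin
      k * toℕ u          ≈⟨ toℕ-smul k u ⟨
      toℕ (smul n k u)   ≡⟨ cong toℕ ku≡kv ⟩
      toℕ (smul n k v)   ≈⟨ toℕ-smul k v ⟩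
      k * toℕ v          ∎
    ∸≡0 : ∀ {a b : Fin n} → k * toℕ a ≈ k * toℕ b → toℕ b ∸ toℕ a ≡ 0
    ∸≡0 {a} {b} ka≈kb = trans (sym (m<n⇒m%n≡m (≤-<-trans (m∸n≤m (toℕ b) (toℕ a)) (toℕ<n b))))
      (n∣m⇒m%n≡0 _ n (coprime-divisor (Coprime.sym k⊥n)
                                      (subst (n ∣_) (sym (*-distribˡ-∸ k (toℕ b) (toℕ a))) (≈⇒∣∸ ka≈kb))))

  private instance
    gcd-nonZero : ∀ {x} → NonZero (gcd n x)
    gcd-nonZero {x} = ≢-nonZero (≢-nonZero⁻¹ n ∘ gcd[m,n]≡0⇒m≡0 {n} {x})

  -- n / gcd n (toℕ g) is the order of g.
  unit-modulo-order : ∀ {g : Fin n} a b → toℕ g ≈ a * b * toℕ g → Coprime b (n / gcd n (toℕ g))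
  unit-modulo-order {g} a b = by-cases (a * b) refl
    where
    G = toℕ g
    by-cases : ∀ c → a * b ≡ c → G ≈ c * G → Coprime b (n / gcd n G)
    by-cases zero _ G≈0 {i} (i∣b , i∣m) =
      ∣1⇒≡1 (∣-trans i∣m (m∣n*o⇒m/gcd[m,o]∣n (subst (n ∣_) (sym (*-identityˡ G)) (≈⇒∣∸ (sym G≈0)))))
    by-cases (suc c) ab≡1+c G≈[1+c]G {i} (i∣b , i∣m) =
      ∣1⇒≡1 (∣m+n∣m⇒∣n (subst (i ∣_) (trans ab≡1+c (+-comm 1 c)) (∣n⇒∣m*n a i∣b))
                       (∣-trans i∣m (m∣n*o⇒m/gcd[m,o]∣n (subst (n ∣_) (m+n∸m≡n G (c * G)) (≈⇒∣∸ G≈[1+c]G)))))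

  -- t = b g, and k = b + m r with m the order of g lifts the unit b modulo m to a unit modulo 2 n.
  generator-multiplier : ∀ {t g} → GeneratorOf n t g → ∃ λ k → Coprime k (2 * n) × smul n k g ≡ t
  generator-multiplier {t} {g} ((a , g≡at) , (b , t≡bg)) = b + m * r , k⊥2n , kg≡t
    where
    G = toℕ g
    d = gcd n G
    m = n / d
    G≈abG : G ≈ a * b * G
    G≈abG = begin
      G                    ≡⟨ cong toℕ g≡at ⟩
      toℕ (smul n a t)     ≈⟨ toℕ-smul a t ⟩
      a * toℕ t            ≈⟨ *-cong-≈ {a} refl (trans (cong (λ v → toℕ v % n) t≡bg) (toℕ-smul b g)) ⟩
      a * (b * G)          ≡⟨ *-assoc a b G ⟨
      a * b * G            ∎
    lift = coprime-lift (2 * n) (≢-nonZero⁻¹ (2 * n) {{m*n≢0 2 n}}) (unit-modulo-order a b G≈abG)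
    r = proj₁ lift
    k⊥2n = proj₂ lift
    kg≡t : smul n (b + m * r) g ≡ t
    kg≡t = toℕ-≈-injective (begin
      toℕ (smul n (b + m * r) g)    ≈⟨ toℕ-smul (b + m * r) g ⟩
      (b + m * r) * G               ≡⟨ expand b m r G ⟩
      b * G + r * (m * G)           ≡⟨ cong (λ x → b * G + r * x) (m/gcd[m,o]*o≡o/gcd[m,o]*m n G) ⟩
      b * G + r * (G / d * n)       ≡⟨ cong (b * G +_) (sym (*-assoc r (G / d) n)) ⟩
      b * G + r * (G / d) * n       ≈⟨ [m+kn]%n≡m%n (b * G) (r * (G / d)) n ⟩
      b * G                         ≈⟨ toℕ-smul b g ⟨
      toℕ (smul n b g)              ≡⟨ cong toℕ t≡bg ⟨
      toℕ t                         ∎)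
      where
      expand : ∀ b m r G → (b + m * r) * G ≡ b * G + r * (m * G)
      expand = solve-∀

-- Sums over Fin n and subsets

∑-++ : ∀ m {n} (f : Fin (m + n) → ℕ) → ∑ f ≡ ∑ (f ∘ (_↑ˡ n)) + ∑ (f ∘ (m ↑ʳ_))
∑-++ zero f = refl
∑-++ (suc m) f = trans (cong (f zero +_) (∑-++ m (f ∘ suc))) (sym (+-assoc (f zero) _ _))

∈-tabulate : ∀ {n} {P : Pred (Fin n) 0ℓ} (P? : Decidable P) {d} → d ∈ tabulate (does ∘ P?) ⇔ P d
∈-tabulate P? {d} = mk⇔
  (λ d∈ → dec-true⁻¹ (P? d) (trans (sym (lookup∘tabulate (does ∘ P?) d)) ([]=⇒lookup d∈)))
  (λ Pd → lookup⇒[]= d _ (trans (lookup∘tabulate (does ∘ P?) d) (dec-true (P? d) Pd)))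

elements : ∀ {n} → Subset n → List (Fin n)
elements [] = []
elements (inside ∷ S) = zero ∷ map suc (elements S)
elements (outside ∷ S) = map suc (elements S)

sum-map-elements : ∀ {n} (S : Subset n) (f : Fin n → ℕ) →
                   sum (map f (elements S)) ≡ ∑[ x < n ] (indicator (does (x ∈? S)) * f x)
sum-map-elements [] f = refl
sum-map-elements (inside ∷ S) f = cong₂ _+_ (sym (+-identityʳ (f zero)))
  (trans (cong sum (sym (map-∘ (elements S)))) (sum-map-elements S (f ∘ suc)))
sum-map-elements (outside ∷ S) f = trans (cong sum (sym (map-∘ (elements S)))) (sum-map-elements S (f ∘ suc))

∑-indicator-unique : ∀ {n} {P : Pred (Fin n) 0ℓ} (P? : Decidable P) → (∀ {x y} → P x → P y → x ≡ y) →
                     ∑[ x < n ] indicator (does (P? x)) ≡ indicator (does (any? P?))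
∑-indicator-unique {zero} P? unique = refl
∑-indicator-unique {suc n} P? unique
  rewrite ∑-indicator-unique (λ x → P? (suc x)) (λ p q → suc-injective (unique p q))
  with P? zero | any? (λ x → P? (suc x))
... | yes P0 | yes (x , Px) = contradiction (unique P0 Px) 0≢1+n
... | yes _  | no _        = refl
... | no _   | _           = refl

-- Walks in the double cover of a circulant

module DoubleCover (n : ℕ) .{{_ : NonZero n}} where

  open Modular n
  open Inverse using (to; strictlyInverseˡ)

  infix 4 _≟ᵥ_
  _≟ᵥ_ : DecidableEquality (BVertex n)
  (u , i) ≟ᵥ (w , j) = Dec.map′ (uncurry (cong₂ _,_)) ,-injective (u ≟ᶠ w ×-dec i ≟ᵇ j)

  enumeration : Fin (n + n) ↔ BVertex n
  enumeration = mk↔ₛ′ toVertex fromVertex to∘from from∘to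
    where
    toVertex : Fin (n + n) → BVertex n
    toVertex i = [ (_, false) , (_, true) ]′ (splitAt n i)
    fromVertex : BVertex n → Fin (n + n)
    fromVertex (v , false) = v ↑ˡ n
    fromVertex (v , true) = n ↑ʳ v
    to∘from : ∀ x → toVertex (fromVertex x) ≡ x
    to∘from (v , false) = cong [ (_, false) , (_, true) ]′ (splitAt-↑ˡ n v n)
    to∘from (v , true) = cong [ (_, false) , (_, true) ]′ (splitAt-↑ʳ n n v)
    from∘to : ∀ i → fromVertex (toVertex i) ≡ i
    from∘to i = trans (fromVertex-[,] (splitAt n i)) (join-splitAt n n i)
      where
      fromVertex-[,] : ∀ s → fromVertex ([ (_, false) , (_, true) ]′ s) ≡ join n n s
      fromVertex-[,] (inj₁ v) = refl
      fromVertex-[,] (inj₂ v) = refl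

  BAdj? : ∀ S x y → Dec (BAdj n S x y)
  BAdj? S (v , false) (w , true) = subₙ n w v ∈? S
  BAdj? S (v , true) (w , false) = subₙ n v w ∈? S
  BAdj? S (v , false) (w , false) = no id
  BAdj? S (v , true) (w , true) = no id

  adjacency : Subset n → BVertex n → BVertex n → ℕ
  adjacency S x y = indicator (does (BAdj? S x y))

  open FiniteWalks enumeration _≟ᵥ_ using (walks; ∑ᵥ; walks-automorphism)

  ∑ᵥ-sides : ∀ i f → ∑ᵥ f ≡ ∑[ v < n ] f (v , i) + ∑[ v < n ] f (v , not i)
  ∑ᵥ-sides false f = trans (∑-++ n (f ∘ to enumeration))
    (cong₂ _+_ (sum-cong-≗ {n} (λ v → cong f (strictlyInverseˡ enumeration (v , false))))
               (sum-cong-≗ {n} (λ v → cong f (strictlyInverseˡ enumeration (v , true)))))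
  ∑ᵥ-sides true f = trans (∑ᵥ-sides false f) (+-comm (∑[ v < n ] f (v , false)) _)

  open CommutingSteps _≟ᶠ_ (λ x v → v +ₙ x) (λ x y v → +ₙ-rightComm v y x) using (walksBy; walksBy-prime)

  ∑-translate : ∀ u (f : Fin n → ℕ) → ∑ f ≡ ∑[ x < n ] f (u +ₙ x)
  ∑-translate u f = sum-permute f (permutation (u +ₙ_) (λ v → subₙ n v u) (+ₙ-subₙ u) (subₙ-+ₙ u))

  ∑-neighbours : ∀ S u (h : Fin n → ℕ) →
                 ∑[ v < n ] (indicator (does (subₙ n v u ∈? S)) * h v) ≡ sum (map (h ∘ (u +ₙ_)) (elements S))
  ∑-neighbours S u h = trans (∑-translate u _)
    (trans (sum-cong-≗ {n} (λ x → cong (λ d → indicator (does (d ∈? S)) * h (u +ₙ x)) (subₙ-+ₙ u x)))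
           (sym (sum-map-elements S (h ∘ (u +ₙ_)))))

  subₙ-∈-swap : ∀ {S} → SymmetricSet n S → ∀ {u v} → subₙ n u v ∈ S → subₙ n v u ∈ S
  subₙ-∈-swap symS {u} {v} uv∈S = subst (_∈ _) (negₙ-subₙ u v) (symS _ uv∈S)

  adjacency-across : ∀ {S} → SymmetricSet n S → ∀ u i v →
                     adjacency S (u , i) (v , not i) ≡ indicator (does (subₙ n v u ∈? S))
  adjacency-across symS u false v = refl
  adjacency-across symS u true v =
    cong indicator (does-⇔ (mk⇔ (subₙ-∈-swap symS {u} {v}) (subₙ-∈-swap symS {v} {u}))
                           (subₙ n u v ∈? _) (subₙ n v u ∈? _))

  adjacency-within : ∀ S u i v → adjacency S (u , i) (v , i) ≡ 0
  adjacency-within S u false v = refl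
  adjacency-within S u true v = refl

  walks-doubleCover : ∀ {S} → SymmetricSet n S → ∀ L u i w j →
    walks (adjacency S) L (u , i) (w , j) ≡ indicator (does (iterate not i L ≟ᵇ j)) * walksBy (elements S) L u w
  walks-doubleCover symS zero u i w j =
    trans (indicator-∧ (does (u ≟ᶠ w)) (does (i ≟ᵇ j))) (*-comm (indicator (does (u ≟ᶠ w))) _)
  walks-doubleCover {S} symS (suc L) u i w j = begin
    ∑ᵥ (λ z → adjacency S (u , i) z * walks (adjacency S) L z (w , j))
      ≡⟨ ∑ᵥ-sides i (λ z → adjacency S (u , i) z * walks (adjacency S) L z (w , j)) ⟩
    ∑[ v < n ] (adjacency S (u , i) (v , i) * walks (adjacency S) L (v , i) (w , j))
      + ∑[ v < n ] (adjacency S (u , i) (v , not i) * walks (adjacency S) L (v , not i) (w , j))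
      ≡⟨ cong₂ _+_ (trans (sum-cong-≗ {n} (λ v → cong (_* walks (adjacency S) L (v , i) (w , j))
                                                      (adjacency-within S u i v)))
                          (sum-replicate-zero n))
                   (sum-cong-≗ {n} (λ v → cong₂ _*_ (adjacency-across symS u i v)
                                                    (walks-doubleCover symS L v (not i) w j))) ⟩
    0 + ∑[ v < n ] (indicator (does (subₙ n v u ∈? S)) * (c * walksBy (elements S) L v w))
      ≡⟨ sum-cong-≗ {n} (λ v → *-Semigroup.x∙yz≈y∙xz (indicator (does (subₙ n v u ∈? S))) c _) ⟩
    ∑[ v < n ] (c * (indicator (does (subₙ n v u ∈? S)) * walksBy (elements S) L v w))
      ≡⟨ *-distribˡ-sum c (λ v → indicator (does (subₙ n v u ∈? S)) * walksBy (elements S) L v w) ⟨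
    c * ∑[ v < n ] (indicator (does (subₙ n v u ∈? S)) * walksBy (elements S) L v w)
      ≡⟨ cong (c *_) (∑-neighbours S u (λ v → walksBy (elements S) L v w)) ⟩
    c * walksBy (elements S) (suc L) u w ∎
    where
    open ≡-Reasoning
    c = indicator (does (iterate not (not i) L ≟ᵇ j))

  ∈-dilate? : ∀ k S d → Dec (∃ λ s → s ∈ S × smul n k s ≡ d)
  ∈-dilate? k S d = any? (λ s → s ∈? S ×-dec smul n k s ≟ᶠ d)

  scale : ℕ → Subset n → Subset n
  scale k S = tabulate (does ∘ ∈-dilate? k S)

  ∈-scale⁻ : ∀ k S {d} → d ∈ scale k S → ∃ λ s → s ∈ S × smul n k s ≡ d
  ∈-scale⁻ k S = Equivalence.to (∈-tabulate (∈-dilate? k S))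

  ∈-scale⁺ : ∀ k {S s} → s ∈ S → smul n k s ∈ scale k S
  ∈-scale⁺ k {S} s∈S = Equivalence.from (∈-tabulate (∈-dilate? k S)) (_ , s∈S , refl)

  scale-symmetric : ∀ {S} → SymmetricSet n S → ∀ k → SymmetricSet n (scale k S)
  scale-symmetric {S} symS k d d∈kS with ∈-scale⁻ k S d∈kS
  ... | s , s∈S , ks≡d =
    subst (_∈ scale k S) (trans (sym (negₙ-smul k s)) (cong (negₙ n) ks≡d)) (∈-scale⁺ k (symS s s∈S))

  scale-scale : ∀ q k S → scale q (scale k S) ≡ scale (q * k) S
  scale-scale q k S = ⊆-antisym lhs⊆rhs rhs⊆lhs
    where
    lhs⊆rhs : scale q (scale k S) ⊆ scale (q * k) S
    lhs⊆rhs d∈ with ∈-scale⁻ q (scale k S) d∈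
    ... | s′ , s′∈kS , qs′≡d with ∈-scale⁻ k S s′∈kS
    ...   | s , s∈S , ks≡s′ =
      subst (_∈ scale (q * k) S) (trans (sym (smul-smul q k s)) (trans (cong (smul n q) ks≡s′) qs′≡d))
            (∈-scale⁺ (q * k) s∈S)
    rhs⊆lhs : scale (q * k) S ⊆ scale q (scale k S)
    rhs⊆lhs d∈ with ∈-scale⁻ (q * k) S d∈
    ... | s , s∈S , qks≡d =
      subst (_∈ scale q (scale k S)) (trans (smul-smul q k s) qks≡d) (∈-scale⁺ q (∈-scale⁺ k s∈S))

  scale-identity : ∀ S → scale 1 S ≡ S
  scale-identity S = ⊆-antisym lhs⊆rhs (λ {d} d∈S → subst (_∈ scale 1 S) (smul-identityˡ d) (∈-scale⁺ 1 d∈S))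
    where
    lhs⊆rhs : scale 1 S ⊆ S
    lhs⊆rhs d∈ with ∈-scale⁻ 1 S d∈
    ... | s , s∈S , s≡d = subst (_∈ S) (trans (sym (smul-identityˡ s)) s≡d) s∈S

  constantWalks : ∀ {p} → Coprime p n → ∀ S u w →
    sum (map (λ x → indicator (does (iterate (_+ₙ x) u p ≟ᶠ w))) (elements S))
      ≡ indicator (does (subₙ n w u ∈? scale p S))
  constantWalks {p} p⊥n S u w = begin
    sum (map (λ x → indicator (does (iterate (_+ₙ x) u p ≟ᶠ w))) (elements S))
      ≡⟨ sum-map-elements S _ ⟩
    ∑[ x < n ] (indicator (does (x ∈? S)) * indicator (does (iterate (_+ₙ x) u p ≟ᶠ w)))
      ≡⟨ sum-cong-≗ {n} (λ x → trans (cong (λ b → indicator (does (x ∈? S)) * indicator b) (hits x))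
                                     (sym (indicator-∧ (does (x ∈? S)) _))) ⟩
    ∑[ x < n ] indicator (does (x ∈? S ×-dec smul n p x ≟ᶠ subₙ n w u))
      ≡⟨ ∑-indicator-unique (λ x → x ∈? S ×-dec smul n p x ≟ᶠ subₙ n w u)
                            (λ (_ , px≡d) (_ , py≡d) → smul-injective p⊥n (trans px≡d (sym py≡d))) ⟩
    indicator (does (∈-dilate? p S (subₙ n w u)))
      ≡⟨ cong indicator (does-⇔ (⇔.sym (∈-tabulate (∈-dilate? p S)))
                                 (∈-dilate? p S (subₙ n w u)) (subₙ n w u ∈? scale p S)) ⟩
    indicator (does (subₙ n w u ∈? scale p S)) ∎
    where
    open ≡-Reasoning
    hits : ∀ x → does (iterate (_+ₙ x) u p ≟ᶠ w) ≡ does (smul n p x ≟ᶠ subₙ n w u)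
    hits x = trans (cong (λ v → does (v ≟ᶠ w)) (iterate-+ₙ x u p))
                   (does-⇔ +ₙ-≡⇔ (u +ₙ smul n p x ≟ᶠ w) (smul n p x ≟ᶠ subₙ n w u))

  ∈-scale-0ₙ : ∀ {k S} → Coprime k n → 0ₙ n ∈ scale k S → 0ₙ n ∈ S
  ∈-scale-0ₙ {k} {S} k⊥n 0∈kS with ∈-scale⁻ k S 0∈kS
  ... | s , s∈S , ks≡0 = subst (_∈ S) (smul-injective k⊥n (trans ks≡0 (sym (smul-0ₙ k)))) s∈S

  adjacency-automorphism : ∀ {S α} → IsBAut n S α → ∀ x y → adjacency S (α x) (α y) ≡ adjacency S x y
  adjacency-automorphism {S} {α} (_ , α-adj) x y =
    cong indicator (sym (does-⇔ (α-adj x y) (BAdj? S x y) (BAdj? S (α x) (α y))))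

  module _ {p} (p-prime : Prime p) (p⊥2n : Coprime p (2 * n)) {S} (symS : SymmetricSet n S) where

    private
      p-odd : ¬ 2 ∣ p
      p-odd 2∣p with p⊥2n (2∣p , m∣m*n n)
      ... | ()

      p⊥n : Coprime p n
      p⊥n = coprime-∣ʳ (n∣m*n 2) p⊥2n

    walks-prime-across : ∀ u i w →
      ∃ λ K → walks (adjacency S) p (u , i) (w , not i) ≡ adjacency (scale p S) (u , i) (w , not i) + K * p
    walks-prime-across u i w with walksBy-prime p-prime (elements S) u w
    ... | K , walksBy≡ = K , (begin
      walks (adjacency S) p (u , i) (w , not i)
        ≡⟨ walks-doubleCover symS p u i w (not i) ⟩
      indicator (does (iterate not i p ≟ᵇ not i)) * walksBy (elements S) p u w
        ≡⟨ cong (λ b → indicator (does (b ≟ᵇ not i)) * walksBy (elements S) p u w) (iterate-not-odd p-odd i) ⟩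
      indicator (does (not i ≟ᵇ not i)) * walksBy (elements S) p u w
        ≡⟨ cong (λ b → indicator b * walksBy (elements S) p u w) (dec-true (not i ≟ᵇ not i) refl) ⟩
      1 * walksBy (elements S) p u w
        ≡⟨ *-identityˡ _ ⟩
      walksBy (elements S) p u w
        ≡⟨ walksBy≡ ⟩
      sum (map (λ x → indicator (does (iterate (_+ₙ x) u p ≟ᶠ w))) (elements S)) + K * p
        ≡⟨ cong (_+ K * p) (trans (constantWalks p⊥n S u w) (sym (adjacency-across (scale-symmetric symS p) u i w))) ⟩
      adjacency (scale p S) (u , i) (w , not i) + K * p ∎)
      where open ≡-Reasoning

    walks-prime-within : ∀ u i w → walks (adjacency S) p (u , i) (w , i) ≡ 0
    walks-prime-within u i w = begin
      walks (adjacency S) p (u , i) (w , i)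
        ≡⟨ walks-doubleCover symS p u i w i ⟩
      indicator (does (iterate not i p ≟ᵇ i)) * walksBy (elements S) p u w
        ≡⟨ cong (λ b → indicator (does (b ≟ᵇ i)) * walksBy (elements S) p u w) (iterate-not-odd p-odd i) ⟩
      indicator (does (not i ≟ᵇ i)) * walksBy (elements S) p u w
        ≡⟨ cong (λ b → indicator b * walksBy (elements S) p u w) (dec-false (not i ≟ᵇ i) (not-¬ refl ∘ sym)) ⟩
      0 ∎
      where open ≡-Reasoning

    walks-prime : ∀ x y → ∃ λ K → walks (adjacency S) p x y ≡ adjacency (scale p S) x y + K * p
    walks-prime (u , false) (w , true) = walks-prime-across u false w
    walks-prime (u , true) (w , false) = walks-prime-across u true w
    walks-prime (u , false) (w , false) = 0 , walks-prime-within u false w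
    walks-prime (u , true) (w , true) = 0 , walks-prime-within u true w

    scale-prime-IsBAut : ∀ {α} → IsBAut n S α → IsBAut n (scale p S) α
    scale-prime-IsBAut {α} aut@(α-bij , _) = α-bij , λ x y →
      does-⇔⁻¹ (BAdj? (scale p S) x y) (BAdj? (scale p S) (α x) (α y)) (indicator-injective (sym (preserved x y)))
      where
      1<p : 1 < p
      1<p = nonTrivial⇒n>1 p {{prime⇒nonTrivial p-prime}}
      preserved : ∀ x y → adjacency (scale p S) (α x) (α y) ≡ adjacency (scale p S) x y
      preserved x y with walks-prime (α x) (α y) | walks-prime x y
      ... | K , αxαy≡ | K′ , xy≡ = residue-unique {K = K} {K′} (indicator< _ 1<p) (indicator< _ 1<p)
        (trans (sym αxαy≡) (trans (walks-automorphism (adjacency S) α-bij (adjacency-automorphism aut) p x y) xy≡))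

  scale-product-IsBAut : ∀ {ps} → All Prime ps → All (λ p → Coprime p (2 * n)) ps →
                         ∀ {S} → SymmetricSet n S → ∀ {α} → IsBAut n S α → IsBAut n (scale (product ps) S) α
  scale-product-IsBAut [] [] {S} symS {α} aut = subst (λ T → IsBAut n T α) (sym (scale-identity S)) aut
  scale-product-IsBAut {p ∷ ps} (p-prime ∷ primes) (p⊥2n ∷ coprimes) {S} symS {α} aut =
    subst (λ T → IsBAut n T α) (scale-scale p (product ps) S)
      (scale-prime-IsBAut p-prime p⊥2n (scale-symmetric symS (product ps))
                          (scale-product-IsBAut primes coprimes symS aut))

  scale-IsBAut : ∀ {k} → Coprime k (2 * n) →
                 ∀ {S} → SymmetricSet n S → ∀ {α} → IsBAut n S α → IsBAut n (scale k S) α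
  scale-IsBAut {k} k⊥2n {S} symS {α} aut = subst (λ m → IsBAut n (scale m S) α) (sym isFactorisation)
    (scale-product-IsBAut factorsPrime factors⊥2n symS aut)
    where
    k≢0 : k ≢ 0
    k≢0 refl with k⊥2n (2 ∣0 , m∣m*n n)
    ... | ()
    instance _ = ≢-nonZero k≢0
    open PrimeFactorisation (factorise k)
    factors⊥2n : All (λ p → Coprime p (2 * n)) factors
    factors⊥2n = All.tabulate λ p∈factors →
      coprime-∣ˡ (∈⇒∣product p∈factors) (subst (λ m → Coprime m (2 * n)) isFactorisation k⊥2n)

corollary4p7 : (n : ℕ) .{{_ : NonZero n}} (S : Subset n) →
    SymmetricSet n S → CayConnected n S → ¬ CayBipartite n S → Loopless n S →
    (α : BVertex n → BVertex n) → IsBAut n S α →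
    α (0ₙ n , false) ≡ (0ₙ n , false) →
    (t : Fin n) → α (0ₙ n , true) ≡ (t , true) →
    (g : Fin n) → GeneratorOf n t g → g ∉ S
corollary4p7 n S symS _ _ loopless α aut α0≡0 t α1≡t g gen g∈S with Modular.generator-multiplier n gen
... | k , k⊥2n , kg≡t =
  loopless (∈-scale-0ₙ (coprime-∣ʳ (n∣m*n 2) k⊥2n) (subst (_∈ scale k S) (subₙ-self (0ₙ n)) 00-adjacent))
  where
  open Modular n
  open DoubleCover n
  0t-adjacent : BAdj n (scale k S) (0ₙ n , false) (t , true)
  0t-adjacent = subst (_∈ scale k S) (trans kg≡t (sym (subₙ-0ₙ t))) (∈-scale⁺ k g∈S)
  00-adjacent : BAdj n (scale k S) (0ₙ n , false) (0ₙ n , true)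
  00-adjacent = Equivalence.from (proj₂ (scale-IsBAut k⊥2n symS aut) _ _)
                  (subst₂ (BAdj n (scale k S)) (sym α0≡0) (sym α1≡t) 0t-adjacent)
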